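{- There is a linear time algorithm to test whether a word over $\mathcal{A}$ is foldable.
   Context: Let $\mathcal{A}$ be a finite alphabet of colors in which each letter $a$ has a unique complementary letter $\overline{a}\in\mathcal{A}$, with $\overline{\overline{a}}=a$ and $\overline{a}\neq a$. Words are considered circularly (the starting point is irrelevant, the order is). A reduction (fold) applied to a circular word of the form $W_1 w_i W_2 w_j W_3$ where $w_j=\overline{w_i}$ replaces it by the multiset of two circular words $\{W_3W_1,\ W_2\}$; a reduction applied to a multiset of words acts on one of its words. A word (or multiset of words) is foldable if some sequence of reductions transforms it into a multiset of empty words. Linear time means time linear in the length of the word. -}

module Defs where

open import Data.Nat using (ℕ; zero; suc; _+_; _*_)
open import Data.Fin using (Fin)
open import Data.Bool using (Bool; true; false)
open import Data.Maybe using (Maybe; just; nothing)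
open import Data.Sum using (_⊎_)
open import Data.Product using (Σ; _×_; _,_)
open import Data.List using (List; []; _∷_; _++_; length)
open import Data.List.Relation.Unary.All using (All)
open import Data.List.Relation.Binary.Permutation.Propositional using (_↭_)
open import Data.Vec using (Vec; []; _∷_; map; replicate; zipWith)
open import Relation.Binary.PropositionalEquality using (_≡_; _≢_)
open import Relation.Nullary using (¬_)
open import Function.Bundles using (_⇔_)

record Alphabet : Set where
  field
    size   : ℕ
    bar    : Fin size → Fin size
    bar-invol : ∀ a → bar (bar a) ≡ a
    bar-nofix : ∀ a → bar a ≢ a

  Letter : Set
  Letter = Fin size

  -- A (circular) word is represented by any of its linear representatives.
  Word : Set
  Word = List Letter

  -- One reduction (fold) step, applied to the first word of a multiset
  -- (the multiset being represented by a list, taken up to permutation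
  -- in 'Foldables' below).
  data Foldables : List Word → Set where
    done : ∀ {ms} → All (_≡ []) ms → Foldables ms
    perm : ∀ {ms ms'} → ms ↭ ms' → Foldables ms' → Foldables ms
    fold : ∀ {rest} (W₁ W₂ W₃ : Word) (a b : Letter) → b ≡ bar a →
           Foldables ((W₃ ++ W₁) ∷ W₂ ∷ rest) →
           Foldables ((W₁ ++ a ∷ W₂ ++ b ∷ W₃) ∷ rest)

  Foldable : Word → Set
  Foldable w = Foldables (w ∷ [])

data Move : Set where
  left right stay : Move

-- A tape over cell alphabet S, as a zipper; cells outside the lists
-- are blank (here: 'nothing').
record Tape (S : Set) : Set where
  constructor tape
  field
    lft  : List (Maybe S)   -- cells left of the head, nearest first
    hd   : Maybe S
    rgt  : List (Maybe S)   -- cells right of the head, nearest first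

open Tape public

moveTape : ∀ {S} → Move → Tape S → Tape S
moveTape left  (tape []       h r) = tape [] nothing (h ∷ r)
moveTape left  (tape (x ∷ l)  h r) = tape l x (h ∷ r)
moveTape right (tape l h [])       = tape (h ∷ l) nothing []
moveTape right (tape l h (x ∷ r))  = tape (h ∷ l) x r
moveTape stay  t                   = t

writeMove : ∀ {S} → Tape S → Maybe S × Move → Tape S
writeMove (tape l _ r) (s , m) = moveTape m (tape l s r)

data Action (Q : Set) (S : Set) (k : ℕ) : Set where
  halt : Bool → Action Q S k
  go   : Q → Vec (Maybe S × Move) k → Action Q S k

-- Cell contents: nothing = blank, just (inj₁ a) = input letter,
-- just (inj₂ g) = work symbol.
record TM (n : ℕ) : Set where
  field
    tapes  : ℕ
    states : ℕ
    work   : ℕ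
    start  : Fin states
    δ      : Fin states → Vec (Maybe (Fin n ⊎ Fin work)) (suc tapes) →
             Action (Fin states) (Fin n ⊎ Fin work) (suc tapes)

  Sym : Set
  Sym = Fin n ⊎ Fin work

  Config : Set
  Config = Fin states × Vec (Tape Sym) (suc tapes)

  initial : List (Fin n) → Config
  initial []       = start , (tape [] nothing [] ∷ replicate _ (tape [] nothing []))
  initial (a ∷ w)  = start , (tape [] (just (Data.Sum.inj₁ a)) (Data.List.map (λ x → just (Data.Sum.inj₁ x)) w)
                              ∷ replicate _ (tape [] nothing []))

  -- run for at most the given number of steps; the halting step counts
  run : ℕ → Config → Maybe Bool
  run zero    _        = nothing
  run (suc f) (q , ts) with δ q (map hd ts)
  ... | halt b  = just b
  ... | go q' a = run f (q' , zipWith writeMove ts a)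

DecidesInLinearTime : ∀ {n} → TM n → (List (Fin n) → Set) → Set
DecidesInLinearTime M P =
  Σ ℕ λ c → Σ ℕ λ d → ∀ w →
    Σ Bool λ b → (TM.run M (c * length w + d) (TM.initial M w) ≡ just b)
                 × ((b ≡ true) ⇔ P w)

-- Read ā as the inverse of a.  A fold replaces W₁ a W₂ ā W₃ by W₂ and the
-- rotation W₃W₁, and free reduction is invariant under cancellation and under
-- rotation (a conjugation), so foldable words are trivial in the free group.
-- Conversely a nonempty freely trivial word contains an adjacent pair a ā:
-- that is a fold with empty W₂, leaving a shorter trivial word.  Free
-- reduction is one left-to-right pass with a stack, which a two-tape machine
-- performs in 2|w| + 1 steps.
module Submission where

open import Defs
open import Data.Product using (Σ; _×_; _,_; proj₁; proj₂)
open import Data.Nat using (ℕ; zero; suc; _+_; _*_; _<_)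
open import Data.Nat.Properties using (+-suc; +-identityʳ; *-suc; n<1+n; m<n⇒m<1+n)
open import Data.Nat.Induction using (<-wellFounded)
open import Data.Fin using (Fin; zero; suc; _≟_)
open import Data.Bool using (true)
open import Data.Maybe using (Maybe; just; nothing; is-nothing)
open import Data.Sum using (_⊎_; inj₁; inj₂)
open import Data.List using (List; []; _∷_; _++_; length; reverse; null)
import Data.List as List
open import Data.List.Properties using (++-assoc; ++-identityʳ; unfold-reverse; length-++-sucʳ; length-++-comm)
open import Data.List.Relation.Unary.All as All using (All; []; _∷_)
open import Data.List.Relation.Binary.Permutation.Propositional using (↭-sym)
open import Data.List.Relation.Binary.Permutation.Propositional.Properties using (All-resp-↭)
open import Data.Vec using (Vec; []; _∷_)
open import Data.Empty using (⊥; ⊥-elim)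
open import Data.Unit using (⊤; tt)
open import Induction.WellFounded using (Acc; acc)
open import Relation.Binary.PropositionalEquality
open import Relation.Nullary using (yes; no)
open import Function.Bundles using (_⇔_; mk⇔)
open import Function.Construct.Composition using (_⇔-∘_)
open import Function.Construct.Symmetry using (⇔-sym)

null≡true⇔≡[] : ∀ {A : Set} (xs : List A) → null xs ≡ true ⇔ xs ≡ []
null≡true⇔≡[] []      = mk⇔ (λ _ → refl) (λ _ → refl)
null≡true⇔≡[] (_ ∷ _) = mk⇔ (λ ()) (λ ())

module FreeReduction (𝒜 : Alphabet) where
  open Alphabet 𝒜
  open ≡-Reasoning

  -- The free reduction of the prefix read so far, most recent letter first.
  Stack : Set
  Stack = List Letter

  push : Stack → Letter → Stack
  push []      x = x ∷ []
  push (t ∷ s) x with t ≟ bar x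
  ... | yes _ = s
  ... | no  _ = x ∷ t ∷ s

  pushAll : Stack → Word → Stack
  pushAll st []      = st
  pushAll st (x ∷ w) = pushAll (push st x) w

  reduce : Word → Stack
  reduce = pushAll []

  Reduced : Stack → Set
  Reduced []           = ⊤
  Reduced (_ ∷ [])     = ⊤
  Reduced (t ∷ t′ ∷ s) = t′ ≢ bar t × Reduced (t′ ∷ s)

  reduced-tail : ∀ {t s} → Reduced (t ∷ s) → Reduced s
  reduced-tail {s = []}    _ = tt
  reduced-tail {s = _ ∷ _} r = proj₂ r

  push-reduced : ∀ st x → Reduced st → Reduced (push st x)
  push-reduced []      x r = tt
  push-reduced (t ∷ s) x r with t ≟ bar x
  ... | yes _  = reduced-tail r
  ... | no t≢x̄ = t≢x̄ , r

  pushAll-reduced : ∀ st w → Reduced st → Reduced (pushAll st w)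
  pushAll-reduced st []      r = r
  pushAll-reduced st (x ∷ w) r = pushAll-reduced (push st x) w (push-reduced st x r)

  reduce-reduced : ∀ w → Reduced (reduce w)
  reduce-reduced w = pushAll-reduced [] w tt

  pushAll-++ : ∀ st u v → pushAll st (u ++ v) ≡ pushAll (pushAll st u) v
  pushAll-++ st []      v = refl
  pushAll-++ st (x ∷ u) v = pushAll-++ (push st x) u v

  bar-bar : ∀ x → x ≡ bar (bar x)
  bar-bar x = sym (bar-invol x)

  -- Reducedness is what rules out a second cancellation when x is pushed
  -- onto a stack whose top is bar x.
  push-cancel : ∀ st x → Reduced st → push (push st x) (bar x) ≡ st
  push-cancel [] x r with x ≟ bar (bar x)
  ... | yes _   = refl
  ... | no x≢x̄̄ = ⊥-elim (x≢x̄̄ (bar-bar x))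
  push-cancel (t ∷ s) x r with t ≟ bar x
  push-cancel (t ∷ [])     x r | yes t≡x̄ = cong (_∷ []) (sym t≡x̄)
  push-cancel (t ∷ t′ ∷ s) x r | yes t≡x̄ with t′ ≟ bar (bar x)
  ... | yes t′≡x = ⊥-elim (proj₁ r (trans t′≡x (cong bar (sym t≡x̄))))
  ... | no  _    = cong (λ z → z ∷ t′ ∷ s) (sym t≡x̄)
  push-cancel (t ∷ s) x r | no _ with x ≟ bar (bar x)
  ... | yes _   = refl
  ... | no x≢x̄̄ = ⊥-elim (x≢x̄̄ (bar-bar x))

  pushAll-reverse-push : ∀ st r x → Reduced st →
                         pushAll st (reverse (push r x)) ≡ push (pushAll st (reverse r)) x
  pushAll-reverse-push st []      x _  = refl
  pushAll-reverse-push st (t ∷ s) x rs with t ≟ bar x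
  ... | yes t≡x̄ = sym (begin
      push (pushAll st (reverse (t ∷ s))) x
        ≡⟨ cong (λ z → push (pushAll st z) x) (unfold-reverse t s) ⟩
      push (pushAll st (reverse s ++ t ∷ [])) x
        ≡⟨ cong (λ z → push z x) (pushAll-++ st (reverse s) (t ∷ [])) ⟩
      push (push u t) x
        ≡⟨ cong (push (push u t)) (trans (bar-bar x) (cong bar (sym t≡x̄))) ⟩
      push (push u t) (bar t)
        ≡⟨ push-cancel u t (pushAll-reduced st (reverse s) rs) ⟩
      u ∎)
    where u = pushAll st (reverse s)
  ... | no _ = begin
      pushAll st (reverse (x ∷ t ∷ s))
        ≡⟨ cong (pushAll st) (unfold-reverse x (t ∷ s)) ⟩
      pushAll st (reverse (t ∷ s) ++ x ∷ [])
        ≡⟨ pushAll-++ st (reverse (t ∷ s)) (x ∷ []) ⟩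
      push (pushAll st (reverse (t ∷ s))) x ∎

  pushAll-reverse-pushAll : ∀ st r w → Reduced st →
    pushAll st (reverse (pushAll r w)) ≡ pushAll (pushAll st (reverse r)) w
  pushAll-reverse-pushAll st r []      _  = refl
  pushAll-reverse-pushAll st r (x ∷ w) rs =
    trans (pushAll-reverse-pushAll st (push r x) w rs)
          (cong (λ z → pushAll z w) (pushAll-reverse-push st r x rs))

  pushAll-trivial : ∀ st w → Reduced st → reduce w ≡ [] → pushAll st w ≡ st
  pushAll-trivial st w rs w≡1 =
    trans (sym (pushAll-reverse-pushAll st [] w rs)) (cong (λ z → pushAll st (reverse z)) w≡1)

  inverse : Word → Word
  inverse []      = []
  inverse (x ∷ w) = inverse w ++ bar x ∷ []

  pushAll-inverse-++ : ∀ st w → Reduced st → pushAll st (inverse w ++ w) ≡ st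
  pushAll-inverse-++ st []      _  = refl
  pushAll-inverse-++ st (x ∷ w) rs = begin
      pushAll st ((inverse w ++ bar x ∷ []) ++ x ∷ w)
        ≡⟨ cong (pushAll st) (++-assoc (inverse w) (bar x ∷ []) (x ∷ w)) ⟩
      pushAll st (inverse w ++ bar x ∷ x ∷ w)
        ≡⟨ pushAll-++ st (inverse w) (bar x ∷ x ∷ w) ⟩
      pushAll (push (push u (bar x)) x) w
        ≡⟨ cong (λ z → pushAll (push (push u (bar x)) z) w) (bar-bar x) ⟩
      pushAll (push (push u (bar x)) (bar (bar x))) w
        ≡⟨ cong (λ z → pushAll z w) (push-cancel u (bar x) (pushAll-reduced st (inverse w) rs)) ⟩
      pushAll u w
        ≡⟨ sym (pushAll-++ st (inverse w) w) ⟩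
      pushAll st (inverse w ++ w)
        ≡⟨ pushAll-inverse-++ st w rs ⟩
      st ∎
    where u = pushAll st (inverse w)

  reduce-rotate : ∀ A B → reduce (A ++ B) ≡ [] → reduce (B ++ A) ≡ []
  reduce-rotate A B AB≡1 = begin
      reduce (B ++ A)                ≡⟨ pushAll-++ [] B A ⟩
      pushAll (reduce B) A           ≡⟨ cong (λ z → pushAll z A) B≡A⁻¹ ⟩
      pushAll (reduce (inverse A)) A ≡⟨ sym (pushAll-++ [] (inverse A) A) ⟩
      reduce (inverse A ++ A)        ≡⟨ pushAll-inverse-++ [] A tt ⟩
      [] ∎
    where
      B≡A⁻¹ : reduce B ≡ reduce (inverse A)
      B≡A⁻¹ = begin
        reduce B
          ≡⟨ cong (λ z → pushAll z B) (sym (pushAll-inverse-++ [] A tt)) ⟩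
        pushAll (reduce (inverse A ++ A)) B
          ≡⟨ sym (pushAll-++ [] (inverse A ++ A) B) ⟩
        reduce ((inverse A ++ A) ++ B)
          ≡⟨ cong reduce (++-assoc (inverse A) A B) ⟩
        reduce (inverse A ++ A ++ B)
          ≡⟨ pushAll-++ [] (inverse A) (A ++ B) ⟩
        pushAll (reduce (inverse A)) (A ++ B)
          ≡⟨ pushAll-trivial (reduce (inverse A)) (A ++ B) (reduce-reduced (inverse A)) AB≡1 ⟩
        reduce (inverse A) ∎

  reduce-fold : ∀ W₁ W₂ W₃ a → reduce (W₃ ++ W₁) ≡ [] → reduce W₂ ≡ [] →
                reduce (W₁ ++ a ∷ W₂ ++ bar a ∷ W₃) ≡ []
  reduce-fold W₁ W₂ W₃ a W₃W₁≡1 W₂≡1 = begin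
      reduce (W₁ ++ a ∷ W₂ ++ bar a ∷ W₃)
        ≡⟨ pushAll-++ [] W₁ _ ⟩
      pushAll (push u a) (W₂ ++ bar a ∷ W₃)
        ≡⟨ pushAll-++ (push u a) W₂ _ ⟩
      pushAll (push (pushAll (push u a) W₂) (bar a)) W₃
        ≡⟨ cong (λ z → pushAll (push z (bar a)) W₃)
                (pushAll-trivial (push u a) W₂ (push-reduced u a (reduce-reduced W₁)) W₂≡1) ⟩
      pushAll (push (push u a) (bar a)) W₃
        ≡⟨ cong (λ z → pushAll z W₃) (push-cancel u a (reduce-reduced W₁)) ⟩
      pushAll u W₃
        ≡⟨ sym (pushAll-++ [] W₁ W₃) ⟩
      reduce (W₁ ++ W₃)
        ≡⟨ reduce-rotate W₃ W₁ W₃W₁≡1 ⟩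
      [] ∎
    where u = reduce W₁

  foldables⇒trivial : ∀ {ms} → Foldables ms → All (λ w → reduce w ≡ []) ms
  foldables⇒trivial (done empty) = All.map (cong reduce) empty
  foldables⇒trivial (perm p f)   = All-resp-↭ (↭-sym p) (foldables⇒trivial f)
  foldables⇒trivial (fold W₁ W₂ W₃ a _ refl f) with foldables⇒trivial f
  ... | W₃W₁≡1 ∷ W₂≡1 ∷ rest = reduce-fold W₁ W₂ W₃ a W₃W₁≡1 W₂≡1 ∷ rest

  CancellingPair : Word → Set
  CancellingPair w = Σ Word λ W₁ → Σ Letter λ a → Σ Word λ W₃ → w ≡ W₁ ++ a ∷ bar a ∷ W₃

  pushAll-empty⇒cancellingPair : ∀ st w → pushAll st w ≡ [] →
    reverse st ++ w ≡ [] ⊎ CancellingPair (reverse st ++ w)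
  pushAll-empty⇒cancellingPair st [] st≡[] =
    inj₁ (trans (++-identityʳ (reverse st)) (cong reverse st≡[]))
  pushAll-empty⇒cancellingPair [] (x ∷ w) e = pushAll-empty⇒cancellingPair (x ∷ []) w e
  pushAll-empty⇒cancellingPair (t ∷ s) (x ∷ w) e with t ≟ bar x
  ... | yes refl = inj₂ (reverse s , bar x , w , (begin
      reverse (bar x ∷ s) ++ x ∷ w        ≡⟨ cong (_++ x ∷ w) (unfold-reverse (bar x) s) ⟩
      (reverse s ++ bar x ∷ []) ++ x ∷ w  ≡⟨ ++-assoc (reverse s) (bar x ∷ []) (x ∷ w) ⟩
      reverse s ++ bar x ∷ x ∷ w          ≡⟨ cong (λ z → reverse s ++ bar x ∷ z ∷ w) (bar-bar x) ⟩
      reverse s ++ bar x ∷ bar (bar x) ∷ w ∎))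
  ... | no _ = Data.Sum.map (trans (sym unfold)) (λ (W₁ , a , W₃ , eq) → W₁ , a , W₃ , trans (sym unfold) eq)
                 (pushAll-empty⇒cancellingPair (x ∷ t ∷ s) w e)
    where
      unfold : reverse (x ∷ t ∷ s) ++ w ≡ reverse (t ∷ s) ++ x ∷ w
      unfold = trans (cong (_++ w) (unfold-reverse x (t ∷ s))) (++-assoc (reverse (t ∷ s)) (x ∷ []) w)

  length-cancellingPair : ∀ W₁ (a b : Letter) W₃ → length (W₁ ++ a ∷ b ∷ W₃) ≡ suc (suc (length (W₃ ++ W₁)))
  length-cancellingPair W₁ a b W₃ = trans (length-++-sucʳ W₁ a (b ∷ W₃))
    (cong suc (trans (length-++-sucʳ W₁ b W₃) (cong suc (length-++-comm W₁ W₃))))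

  trivial⇒foldables : ∀ w {rest} → Acc _<_ (length w) → All (_≡ []) rest →
                      reduce w ≡ [] → Foldables (w ∷ rest)
  trivial⇒foldables w (acc shorter) rest w≡1 with pushAll-empty⇒cancellingPair [] w w≡1
  ... | inj₁ refl = done (refl ∷ rest)
  ... | inj₂ (W₁ , a , W₃ , refl) =
    fold W₁ [] W₃ a (bar a) refl
      (trivial⇒foldables (W₃ ++ W₁) (shorter W₃W₁<w) (refl ∷ rest) (reduce-rotate W₁ W₃ W₁W₃≡1))
    where
      W₃W₁<w : length (W₃ ++ W₁) < length (W₁ ++ a ∷ bar a ∷ W₃)
      W₃W₁<w = subst (length (W₃ ++ W₁) <_) (sym (length-cancellingPair W₁ a (bar a) W₃))
                     (m<n⇒m<1+n (n<1+n _))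
      W₁W₃≡1 : reduce (W₁ ++ W₃) ≡ []
      W₁W₃≡1 = begin
        reduce (W₁ ++ W₃)                        ≡⟨ pushAll-++ [] W₁ W₃ ⟩
        pushAll u W₃                             ≡⟨ cong (λ z → pushAll z W₃) (sym (push-cancel u a (reduce-reduced W₁))) ⟩
        pushAll (push (push u a) (bar a)) W₃     ≡⟨ sym (pushAll-++ [] W₁ (a ∷ bar a ∷ W₃)) ⟩
        reduce (W₁ ++ a ∷ bar a ∷ W₃)            ≡⟨ w≡1 ⟩
        [] ∎
        where u = reduce W₁

  foldable⇔trivial : ∀ w → Foldable w ⇔ reduce w ≡ []
  foldable⇔trivial w = mk⇔ (λ f → All.head (foldables⇒trivial f))
                           (trivial⇒foldables w (<-wellFounded (length w)) [])

-- The stack tape holds the stack bottom-to-top from left to right with the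
-- head on the top cell, which is blank when the stack is empty.  Pushing
-- takes two steps (move up, then write), popping one.
module StackMachine (𝒜 : Alphabet) where
  open Alphabet 𝒜
  open FreeReduction 𝒜

  Cell : Set
  Cell = Maybe (Letter ⊎ Fin 0)

  letter : Letter → Cell
  letter a = just (inj₁ a)

  -- State zero scans the input; state suc x still has to write x on the stack.
  State : Set
  State = Fin (suc size)

  Instruction : Set
  Instruction = Action State (Letter ⊎ Fin 0) 2

  pushing : Letter → Cell → Instruction
  pushing x top = go (suc x) ((letter x , right) ∷ (top , right) ∷ [])

  scan : Letter → Cell → Instruction
  scan x (just (inj₁ t)) with t ≟ bar x
  ... | yes _ = go zero ((letter x , right) ∷ (nothing , left) ∷ [])
  ... | no  _ = pushing x (letter t)
  scan x nothing         = pushing x nothing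
  scan x (just (inj₂ ()))

  transition : State → Vec Cell 2 → Instruction
  transition zero    (nothing ∷ top ∷ [])        = halt (is-nothing top)
  transition zero    (just (inj₁ x) ∷ top ∷ [])  = scan x top
  transition zero    (just (inj₂ ()) ∷ _ ∷ [])
  transition (suc x) (input ∷ _ ∷ [])            = go zero ((input , stay) ∷ (letter x , stay) ∷ [])

  machine : TM size
  machine = record { tapes = 1 ; states = suc size ; work = 0 ; start = zero ; δ = transition }

  InputOn : Word → Tape (Letter ⊎ Fin 0) → Set
  InputOn []      t = hd t ≡ nothing
  InputOn (a ∷ w) t = hd t ≡ letter a × rgt t ≡ List.map letter w

  StackCells : Stack → List Cell → Set
  StackCells []       []      = ⊤
  StackCells []       (c ∷ _) = c ≡ nothing
  StackCells (_ ∷ _)  []      = ⊥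
  StackCells (a ∷ st) (c ∷ l) = c ≡ letter a × StackCells st l

  StackOn : Stack → Tape (Letter ⊎ Fin 0) → Set
  StackOn []       t = hd t ≡ nothing
  StackOn (a ∷ st) t = hd t ≡ letter a × StackCells st (lft t)

  InputOn-advance : ∀ x w t → InputOn (x ∷ w) t → InputOn w (moveTape right t)
  InputOn-advance x []      (tape l h [])      (refl , refl) = refl
  InputOn-advance x (y ∷ w) (tape l h (_ ∷ _)) (refl , refl) = refl , refl

  lft-moveRight : ∀ (l : List Cell) h r → lft (moveTape right (tape l h r)) ≡ h ∷ l
  lft-moveRight l h []      = refl
  lft-moveRight l h (_ ∷ _) = refl

  StackOn⇒StackCells : ∀ st t → StackOn st t → StackCells st (hd t ∷ lft t)
  StackOn⇒StackCells []      t top         = top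
  StackOn⇒StackCells (a ∷ s) t (top , rest) = top , rest

  StackOn-push : ∀ st x t → StackOn st t →
                 StackOn (x ∷ st) (writeMove (moveTape right t) (letter x , stay))
  StackOn-push st x (tape l h r) s =
    refl , subst (StackCells st) (sym (lft-moveRight l h r)) (StackOn⇒StackCells st (tape l h r) s)

  StackOn-pop : ∀ st (l : List Cell) r → StackCells st l → StackOn st (moveTape left (tape l nothing r))
  StackOn-pop []      []      r _ = refl
  StackOn-pop []      (_ ∷ l) r c = c
  StackOn-pop (a ∷ s) (_ ∷ l) r c = c

  steps : Word → ℕ
  steps []      = 1
  steps (_ ∷ w) = 2 + steps w

  steps≡ : ∀ w → steps w ≡ 2 * length w + 1
  steps≡ []      = refl
  steps≡ (_ ∷ w) = trans (cong (2 +_) (steps≡ w)) (cong (_+ 1) (sym (*-suc 2 (length w))))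

  run-simulates-pushAll : ∀ w st t₀ t₁ slack → InputOn w t₀ → StackOn st t₁ →
    TM.run machine (steps w + slack) (zero , t₀ ∷ t₁ ∷ []) ≡ just (null (pushAll st w))
  run-simulates-pushAll [] []      (tape _ _ _) (tape _ _ _) _ refl refl       = refl
  run-simulates-pushAll [] (_ ∷ _) (tape _ _ _) (tape _ _ _) _ refl (refl , _) = refl
  run-simulates-pushAll (x ∷ w) [] t₀@(tape _ _ _) t₁@(tape _ _ _) slack i@(refl , refl) refl =
    run-simulates-pushAll w (x ∷ []) _ _ slack (InputOn-advance x w t₀ i) (StackOn-push [] x t₁ refl)
  run-simulates-pushAll (x ∷ w) (t ∷ s) t₀@(tape _ _ _) t₁@(tape l₁ _ r₁) slack i@(refl , refl) (refl , c)
    with t ≟ bar x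
  ... | yes _ = subst (λ n → TM.run machine n popped ≡ just (null (pushAll s w))) (+-suc (steps w) slack)
                  (run-simulates-pushAll w s _ _ (suc slack) (InputOn-advance x w t₀ i) (StackOn-pop s l₁ r₁ c))
      where
        popped : TM.Config machine
        popped = zero , moveTape right t₀ ∷ moveTape left (tape l₁ nothing r₁) ∷ []
  ... | no _  = run-simulates-pushAll w (x ∷ t ∷ s) _ _ slack (InputOn-advance x w t₀ i)
                  (StackOn-push (t ∷ s) x t₁ (refl , c))

  run-machine : ∀ w → TM.run machine (2 * length w + 1) (TM.initial machine w) ≡ just (null (reduce w))
  run-machine w = subst (λ n → TM.run machine n (TM.initial machine w) ≡ just (null (reduce w)))
                        (trans (+-identityʳ (steps w)) (steps≡ w)) (run-initial w)
    where
      run-initial : ∀ v → TM.run machine (steps v + 0) (TM.initial machine v) ≡ just (null (reduce v))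
      run-initial []      = refl
      run-initial (a ∷ v) = run-simulates-pushAll (a ∷ v) [] _ (tape [] nothing []) 0 (refl , refl) refl

proposition3 : (𝒜 : Alphabet) →
    Σ (TM (Alphabet.size 𝒜)) λ M → DecidesInLinearTime M (Alphabet.Foldable 𝒜)
proposition3 𝒜 = machine , 2 , 1 , λ w →
    null (reduce w) , run-machine w , ⇔-sym (foldable⇔trivial w) ⇔-∘ null≡true⇔≡[] (reduce w)
  where
    open FreeReduction 𝒜
    open StackMachine 𝒜
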